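{- Let $n\ge 2$ with $n\equiv 2\pmod 4$, let $d\ge0$, and let $C$ be an $n\times n$ circulant matrix with generator $(c_0,\ldots,c_{n-1})$ such that $c_0=d$, $c_j\in\{1,-1\}$ for $j=1,\ldots,n-1$, and $CC^T=(d^2+n-1)I$. Then $C$ is symmetric.
   Context: A circulant matrix of order $n$ with generator $(c_0,c_1,\ldots,c_{n-1})$ is the $n\times n$ matrix whose entry in row $i$ and column $j$ (indices $0,\ldots,n-1$) is $c_{(j-i)\bmod n}$. -}

module Defs where

open import Data.Nat as ℕ using (ℕ; zero; suc; _∸_; NonZero; _%_)
open import Data.Nat.DivMod using (m%n<n)
open import Data.Fin using (Fin; toℕ; fromℕ<; _≟_)
open import Relation.Nullary using (yes; no)
open import Data.Integer using (ℤ; _+_; _*_; +_)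
open import Relation.Binary.PropositionalEquality using (_≡_)

diffMod : (n : ℕ) .{{_ : NonZero n}} → Fin n → Fin n → Fin n
diffMod n i j = fromℕ< (m%n<n ((n ℕ.+ toℕ j) ∸ toℕ i) n)

circulant : (n : ℕ) .{{_ : NonZero n}} → (Fin n → ℤ) → Fin n → Fin n → ℤ
circulant n c i j = c (diffMod n i j)

∑ : (n : ℕ) → (Fin n → ℤ) → ℤ
∑ zero f = + 0
∑ (suc n) f = f Fin.zero + ∑ n (λ k → f (Fin.suc k))

transpose : {n : ℕ} → (Fin n → Fin n → ℤ) → Fin n → Fin n → ℤ
transpose M i j = M j i

_⊗_ : {n : ℕ} → (Fin n → Fin n → ℤ) → (Fin n → Fin n → ℤ) → Fin n → Fin n → ℤ
_⊗_ {n} A B i j = ∑ n (λ k → A i k * B k j)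

scalarI : (n : ℕ) → ℤ → Fin n → Fin n → ℤ
scalarI n a i j with i ≟ j
... | yes _ = a
... | no _ = + 0

Symmetric : {n : ℕ} → (Fin n → Fin n → ℤ) → Set
Symmetric M = ∀ i j → M i j ≡ M j i

fin0 : (n : ℕ) .{{_ : NonZero n}} → Fin n
fin0 (suc n) = Fin.zero

-- Suppose rows i ≠ j of C disagree at the mirrored entries, i.e. c(j−i) = −c(i−j).
-- Expanding 0 = ⟨row i, row j⟩ with x y = (x−1)(y−1) + (x−1) + (y−1) + 1, every
-- product (x−1)(y−1) of two ±1 entries is divisible by 4, the two products through
-- the diagonal entry d sum to (d−1)(c(j−i) + c(i−j)) − 2(d−1) = −2(d−1), and both rows,
-- being permutations of c, have Σ(x−1) = Σ(c−1) ≡ d−1 (mod 2). Everything cancels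
-- modulo 4 except n, so 4 ∣ n, contradicting n ≡ 2 (mod 4).
module Submission where

open import Defs
open import Algebra.Properties.CommutativeMonoid.Sum as MonoidSum using ()
open import Data.Empty using (⊥-elim)
open import Data.Fin using (Fin; zero; suc; toℕ; fromℕ<; _≟_)
open import Data.Fin.Permutation using (Permutation; permutation)
open import Data.Fin.Properties using (toℕ-fromℕ<; toℕ-injective; toℕ<n; suc-injective)
open import Data.Integer using (ℤ; +_; -_; _+_; _*_; _-_; 0ℤ; 1ℤ; -1ℤ)
open import Data.Integer.Divisibility.Signed
  using (_∣_; divides; ∣⇒∣ᵤ; ∣m∣n⇒∣m+n; ∣m∣n⇒∣m-n; ∣n⇒∣m*n; *-monoʳ-∣)
open import Data.Integer.Properties using (+-0-commutativeMonoid)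
open import Data.Integer.Tactic.RingSolver using (solve-∀)
open import Data.Nat as ℕ using (ℕ; zero; suc; _≤_; _%_; _∸_; NonZero)
open import Data.Nat.Divisibility using (n∣m⇒m%n≡0)
open import Data.Nat.DivMod
  using (m%n<n; %-distribˡ-+; m%n%n≡m%n; [m+n]%n≡m%n; m<n⇒m%n≡m)
import Data.Nat.Properties as ℕ
open import Data.Sum using (_⊎_; inj₁; inj₂)
open import Function using (_∘_)
open import Relation.Nullary using (¬_; yes; no)
open import Relation.Binary.PropositionalEquality
  using (_≡_; _≢_; refl; sym; trans; cong; cong₂; subst; module ≡-Reasoning)

open MonoidSum +-0-commutativeMonoid using (sum; sum-cong-≗; ∑-distrib-+; sum-permute)

module _ {n : ℕ} .{{_ : NonZero n}} where

  [m%n+k]%n≡[m+k]%n : ∀ m k → (m % n ℕ.+ k) % n ≡ (m ℕ.+ k) % n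
  [m%n+k]%n≡[m+k]%n m k = begin
    (m % n ℕ.+ k) % n            ≡⟨ %-distribˡ-+ (m % n) k n ⟩
    (m % n % n ℕ.+ k % n) % n    ≡⟨ cong (λ r → (r ℕ.+ k % n) % n) (m%n%n≡m%n m n) ⟩
    (m % n ℕ.+ k % n) % n        ≡⟨ %-distribˡ-+ m k n ⟨
    (m ℕ.+ k) % n                ∎
    where open ≡-Reasoning

  -- Adding k is undone modulo n by adding n ∸ k.
  %-cancelʳ-+ : ∀ {a b} k → k ≤ n → (a ℕ.+ k) % n ≡ (b ℕ.+ k) % n → a % n ≡ b % n
  %-cancelʳ-+ {a} {b} k k≤n eq = begin
    a % n                                ≡⟨ undo a ⟩
    ((a ℕ.+ k) % n ℕ.+ (n ∸ k)) % n      ≡⟨ cong (λ r → (r ℕ.+ (n ∸ k)) % n) eq ⟩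
    ((b ℕ.+ k) % n ℕ.+ (n ∸ k)) % n      ≡⟨ undo b ⟨
    b % n                                ∎
    where
    open ≡-Reasoning
    undo : ∀ m → m % n ≡ ((m ℕ.+ k) % n ℕ.+ (n ∸ k)) % n
    undo m = begin
      m % n                              ≡⟨ [m+n]%n≡m%n m n ⟨
      (m ℕ.+ n) % n                      ≡⟨ cong (λ r → (m ℕ.+ r) % n) (ℕ.m+[n∸m]≡n k≤n) ⟨
      (m ℕ.+ (k ℕ.+ (n ∸ k))) % n        ≡⟨ cong (_% n) (ℕ.+-assoc m k (n ∸ k)) ⟨
      (m ℕ.+ k ℕ.+ (n ∸ k)) % n          ≡⟨ [m%n+k]%n≡[m+k]%n (m ℕ.+ k) (n ∸ k) ⟨
      ((m ℕ.+ k) % n ℕ.+ (n ∸ k)) % n    ∎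

toℕ-fin0 : ∀ n .{{_ : NonZero n}} → toℕ (fin0 n) ≡ 0
toℕ-fin0 (suc n) = refl

module _ {n : ℕ} .{{_ : NonZero n}} where

  diffMod-spec : ∀ i j → (toℕ (diffMod n i j) ℕ.+ toℕ i) % n ≡ toℕ j
  diffMod-spec i j = begin
    (toℕ (diffMod n i j) ℕ.+ toℕ i) % n        ≡⟨ cong (λ r → (r ℕ.+ toℕ i) % n) (toℕ-fromℕ< _) ⟩
    ((n ℕ.+ toℕ j ∸ toℕ i) % n ℕ.+ toℕ i) % n  ≡⟨ [m%n+k]%n≡[m+k]%n (n ℕ.+ toℕ j ∸ toℕ i) (toℕ i) ⟩
    (n ℕ.+ toℕ j ∸ toℕ i ℕ.+ toℕ i) % n        ≡⟨ cong (_% n) (ℕ.m∸n+n≡m i≤n+j) ⟩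
    (n ℕ.+ toℕ j) % n                          ≡⟨ cong (_% n) (ℕ.+-comm n (toℕ j)) ⟩
    (toℕ j ℕ.+ n) % n                          ≡⟨ [m+n]%n≡m%n (toℕ j) n ⟩
    toℕ j % n                                  ≡⟨ m<n⇒m%n≡m (toℕ<n j) ⟩
    toℕ j                                      ∎
    where
    open ≡-Reasoning
    i≤n+j : toℕ i ≤ n ℕ.+ toℕ j
    i≤n+j = ℕ.≤-trans (ℕ.<⇒≤ (toℕ<n i)) (ℕ.m≤m+n n (toℕ j))

  diffMod-unique : ∀ i j k → (toℕ k ℕ.+ toℕ i) % n ≡ toℕ j → diffMod n i j ≡ k
  diffMod-unique i j k eq = toℕ-injective (begin
    toℕ (diffMod n i j)      ≡⟨ m<n⇒m%n≡m (toℕ<n (diffMod n i j)) ⟨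
    toℕ (diffMod n i j) % n  ≡⟨ %-cancelʳ-+ (toℕ i) (ℕ.<⇒≤ (toℕ<n i)) (trans (diffMod-spec i j) (sym eq)) ⟩
    toℕ k % n                ≡⟨ m<n⇒m%n≡m (toℕ<n k) ⟩
    toℕ k                    ∎)
    where open ≡-Reasoning

  diffMod-self : ∀ i → diffMod n i i ≡ fin0 n
  diffMod-self i = diffMod-unique i i (fin0 n) (begin
    (toℕ (fin0 n) ℕ.+ toℕ i) % n  ≡⟨ cong (λ r → (r ℕ.+ toℕ i) % n) (toℕ-fin0 n) ⟩
    toℕ i % n                     ≡⟨ m<n⇒m%n≡m (toℕ<n i) ⟩
    toℕ i                         ∎)
    where open ≡-Reasoning

  diffMod≡fin0⇒≡ : ∀ i j → diffMod n i j ≡ fin0 n → i ≡ j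
  diffMod≡fin0⇒≡ i j eq = toℕ-injective (begin
    toℕ i                                ≡⟨ m<n⇒m%n≡m (toℕ<n i) ⟨
    toℕ i % n                            ≡⟨ cong (λ r → (r ℕ.+ toℕ i) % n) (toℕ-fin0 n) ⟨
    (toℕ (fin0 n) ℕ.+ toℕ i) % n         ≡⟨ cong (λ k → (toℕ k ℕ.+ toℕ i) % n) eq ⟨
    (toℕ (diffMod n i j) ℕ.+ toℕ i) % n  ≡⟨ diffMod-spec i j ⟩
    toℕ j                                ∎)
    where open ≡-Reasoning

  diffMod-permutation : Fin n → Permutation n n
  diffMod-permutation i = permutation (diffMod n i) addMod
    (λ k → diffMod-unique i (addMod k) k (sym (toℕ-fromℕ< _)))
    (λ j → toℕ-injective (trans (toℕ-fromℕ< _) (diffMod-spec i j)))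
    where
    addMod : Fin n → Fin n
    addMod k = fromℕ< (m%n<n (toℕ k ℕ.+ toℕ i) n)

  sum-∘-diffMod : ∀ i (f : Fin n → ℤ) → sum (f ∘ diffMod n i) ≡ sum f
  sum-∘-diffMod i f = sym (sum-permute f (diffMod-permutation i))

∑≡sum : ∀ n (f : Fin n → ℤ) → ∑ n f ≡ sum f
∑≡sum zero    f = refl
∑≡sum (suc n) f = cong (_+_ (f zero)) (∑≡sum n (f ∘ suc))

sum-1 : ∀ n → sum {n} (λ _ → 1ℤ) ≡ + n
sum-1 zero    = refl
sum-1 (suc n) = cong (_+_ 1ℤ) (sum-1 n)

sum-*-expand : ∀ {n} (x y : Fin n → ℤ) →
  sum (λ k → x k * y k) ≡
  sum (λ k → (x k - 1ℤ) * (y k - 1ℤ)) + sum (λ k → x k - 1ℤ) + sum (λ k → y k - 1ℤ) + + n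
sum-*-expand {n} x y = begin
  sum (λ k → x k * y k)                   ≡⟨ sum-cong-≗ (λ k → expand (x k) (y k)) ⟩
  sum (λ k → P k + X k + Y k + 1ℤ)        ≡⟨ ∑-distrib-+ {n} (λ k → P k + X k + Y k) (λ _ → 1ℤ) ⟩
  sum (λ k → P k + X k + Y k) + sum {n} (λ _ → 1ℤ)
    ≡⟨ cong₂ _+_ (∑-distrib-+ {n} (λ k → P k + X k) Y) (sum-1 n) ⟩
  sum (λ k → P k + X k) + sum Y + + n     ≡⟨ cong (λ s → s + sum Y + + n) (∑-distrib-+ P X) ⟩
  sum P + sum X + sum Y + + n             ∎
  where
  open ≡-Reasoning
  P X Y : Fin n → ℤ
  P k = (x k - 1ℤ) * (y k - 1ℤ)
  X k = x k - 1ℤ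
  Y k = y k - 1ℤ
  expand : ∀ a b → a * b ≡ (a - 1ℤ) * (b - 1ℤ) + (a - 1ℤ) + (b - 1ℤ) + 1ℤ
  expand = solve-∀

module _ {m : ℤ} where

  ∣-sum : ∀ {n} (f : Fin n → ℤ) → (∀ k → m ∣ f k) → m ∣ sum f
  ∣-sum {zero}  f m∣f = divides 0ℤ refl
  ∣-sum {suc n} f m∣f = ∣m∣n⇒∣m+n (m∣f zero) (∣-sum (f ∘ suc) (m∣f ∘ suc))

  ∣-sum-except : ∀ {n} (f : Fin n → ℤ) i → (∀ k → k ≢ i → m ∣ f k) → m ∣ sum f - f i
  ∣-sum-except {suc n} f zero m∣f =
    subst (m ∣_) (cancel (f zero) (sum (f ∘ suc)))
      (∣-sum (f ∘ suc) (λ k → m∣f (suc k) λ ()))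
    where
    cancel : ∀ a s → s ≡ a + s - a
    cancel = solve-∀
  ∣-sum-except {suc n} f (suc i) m∣f =
    subst (m ∣_) (reassoc (f zero) (sum (f ∘ suc)) (f (suc i)))
      (∣m∣n⇒∣m+n (m∣f zero λ ())
        (∣-sum-except (f ∘ suc) i (λ k k≢i → m∣f (suc k) (k≢i ∘ suc-injective))))
    where
    reassoc : ∀ a s b → a + (s - b) ≡ a + s - b
    reassoc = solve-∀

  ∣-sum-except₂ : ∀ {n} (f : Fin n → ℤ) {i j} → i ≢ j →
                  (∀ k → k ≢ i → k ≢ j → m ∣ f k) → m ∣ sum f - (f i + f j)
  ∣-sum-except₂ {suc n} f {zero} {zero} i≢j m∣f = ⊥-elim (i≢j refl)
  ∣-sum-except₂ {suc n} f {zero} {suc j} i≢j m∣f =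
    subst (m ∣_) (cancel (f zero) (sum (f ∘ suc)) (f (suc j)))
      (∣-sum-except (f ∘ suc) j (λ k k≢j → m∣f (suc k) (λ ()) (k≢j ∘ suc-injective)))
    where
    cancel : ∀ a s b → s - b ≡ a + s - (a + b)
    cancel = solve-∀
  ∣-sum-except₂ {suc n} f {suc i} {zero} i≢j m∣f =
    subst (m ∣_) (cancel (f zero) (sum (f ∘ suc)) (f (suc i)))
      (∣-sum-except (f ∘ suc) i (λ k k≢i → m∣f (suc k) (k≢i ∘ suc-injective) (λ ())))
    where
    cancel : ∀ a s b → s - b ≡ a + s - (b + a)
    cancel = solve-∀
  ∣-sum-except₂ {suc n} f {suc i} {suc j} i≢j m∣f =
    subst (m ∣_) (reassoc (f zero) (sum (f ∘ suc)) (f (suc i)) (f (suc j)))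
      (∣m∣n⇒∣m+n (m∣f zero (λ ()) (λ ()))
        (∣-sum-except₂ (f ∘ suc) (i≢j ∘ cong suc)
          (λ k k≢i k≢j → m∣f (suc k) (k≢i ∘ suc-injective) (k≢j ∘ suc-injective))))
    where
    reassoc : ∀ a s b c → a + (s - (b + c)) ≡ a + s - (b + c)
    reassoc = solve-∀

IsUnit : ℤ → Set
IsUnit u = u ≡ 1ℤ ⊎ u ≡ -1ℤ

unit⇒2∣pred : ∀ {u} → IsUnit u → + 2 ∣ u - 1ℤ
unit⇒2∣pred (inj₁ refl) = divides 0ℤ refl
unit⇒2∣pred (inj₂ refl) = divides -1ℤ refl

2∣⇒2∣⇒4∣* : ∀ {a b} → + 2 ∣ a → + 2 ∣ b → + 4 ∣ a * b
2∣⇒2∣⇒4∣* (divides p refl) (divides q refl) = divides (p * q) (swap p q)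
  where
  swap : ∀ p q → p * + 2 * (q * + 2) ≡ p * q * + 4
  swap = solve-∀

units-≡-or-opposite : ∀ {u v} → IsUnit u → IsUnit v → u ≡ v ⊎ u + v ≡ 0ℤ
units-≡-or-opposite (inj₁ refl) (inj₁ refl) = inj₁ refl
units-≡-or-opposite (inj₁ refl) (inj₂ refl) = inj₂ refl
units-≡-or-opposite (inj₂ refl) (inj₁ refl) = inj₂ refl
units-≡-or-opposite (inj₂ refl) (inj₂ refl) = inj₁ refl

%4≡2⇒4∤ : ∀ {n} → n % 4 ≡ 2 → ¬ (+ 4 ∣ + n)
%4≡2⇒4∤ {n} n%4≡2 4∣n with trans (sym n%4≡2) (n∣m⇒m%n≡0 n 4 (∣⇒∣ᵤ 4∣n))
... | ()

module _ {n : ℕ} .{{_ : NonZero n}} (c : Fin n → ℤ) where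

  circulant-diagonal : ∀ {D} → c (fin0 n) ≡ D → ∀ r → circulant n c r r ≡ D
  circulant-diagonal c₀≡D r = trans (cong c (diffMod-self r)) c₀≡D

  circulant-off-diagonal-unit : (∀ j → j ≢ fin0 n → IsUnit (c j)) →
                                ∀ r k → k ≢ r → IsUnit (circulant n c r k)
  circulant-off-diagonal-unit units r k k≢r =
    units (diffMod n r k) (k≢r ∘ sym ∘ diffMod≡fin0⇒≡ r k)

module OppositeMirrorEntries
  {n : ℕ} .{{_ : NonZero n}} (D : ℤ) (c : Fin n → ℤ)
  (c₀≡D : c (fin0 n) ≡ D) (units : ∀ j → j ≢ fin0 n → IsUnit (c j))
  {i j : Fin n} (i≢j : i ≢ j)
  where

  x y : Fin n → ℤ
  x = circulant n c i
  y = circulant n c j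

  a a′ : ℤ
  a  = x j
  a′ = y i

  S : ℤ
  S = sum (λ m → c m - 1ℤ)

  2∣S-[D-1] : + 2 ∣ S - (D - 1ℤ)
  2∣S-[D-1] = subst (λ t → + 2 ∣ S - (t - 1ℤ)) c₀≡D
    (∣-sum-except (λ m → c m - 1ℤ) (fin0 n) (λ m m≢0 → unit⇒2∣pred (units m m≢0)))

  G E : ℤ
  G = sum (λ k → (x k - 1ℤ) * (y k - 1ℤ))
  E = (D - 1ℤ) * (a′ - 1ℤ) + (a - 1ℤ) * (D - 1ℤ)

  -- Only at k = i and k = j, where a row holds D, can (x k − 1)(y k − 1) escape 4 ∣ _.
  4∣G-E : + 4 ∣ G - E
  4∣G-E = subst (λ t → + 4 ∣ G - t)
    (cong₂ (λ u v → (u - 1ℤ) * (a′ - 1ℤ) + (a - 1ℤ) * (v - 1ℤ))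
      (circulant-diagonal c c₀≡D i) (circulant-diagonal c c₀≡D j))
    (∣-sum-except₂ (λ k → (x k - 1ℤ) * (y k - 1ℤ)) i≢j
      (λ k k≢i k≢j → 2∣⇒2∣⇒4∣* (unit⇒2∣pred (circulant-off-diagonal-unit c units i k k≢i))
                                (unit⇒2∣pred (circulant-off-diagonal-unit c units j k k≢j))))

  4∣G+S+S : a + a′ ≡ 0ℤ → + 4 ∣ G + S + S
  4∣G+S+S a+a′≡0 = subst (+ 4 ∣_) (sym (regroup G S D a a′))
    (∣m∣n⇒∣m+n (∣m∣n⇒∣m+n 4∣G-E (*-monoʳ-∣ (+ 2) 2∣S-[D-1]))
      (∣n⇒∣m*n (D - 1ℤ) (subst (+ 4 ∣_) (sym a+a′≡0) (divides 0ℤ refl))))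
    where
    regroup : ∀ G S D a a′ → G + S + S ≡
      (G - ((D - 1ℤ) * (a′ - 1ℤ) + (a - 1ℤ) * (D - 1ℤ))) + + 2 * (S - (D - 1ℤ)) + (D - 1ℤ) * (a + a′)
    regroup = solve-∀

  row-expansion : sum (λ k → x k * y k) ≡ G + S + S + + n
  row-expansion = begin
    sum (λ k → x k * y k)                                  ≡⟨ sum-*-expand x y ⟩
    G + sum (λ k → x k - 1ℤ) + sum (λ k → y k - 1ℤ) + + n
      ≡⟨ cong₂ (λ s t → G + s + t + + n) (row-sum i) (row-sum j) ⟩
    G + S + S + + n                                        ∎
    where
    open ≡-Reasoning
    row-sum : ∀ r → sum (λ k → circulant n c r k - 1ℤ) ≡ S
    row-sum r = sum-∘-diffMod r (λ m → c m - 1ℤ)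

  4∣n : sum (λ k → x k * y k) ≡ 0ℤ → a + a′ ≡ 0ℤ → + 4 ∣ + n
  4∣n orthogonal a+a′≡0 = subst (+ 4 ∣_) (cancel (G + S + S) (+ n))
    (∣m∣n⇒∣m-n (subst (+ 4 ∣_) (trans (sym orthogonal) row-expansion) (divides 0ℤ refl))
               (4∣G+S+S a+a′≡0))
    where
    cancel : ∀ s t → s + t - s ≡ t
    cancel = solve-∀

scalarI-off-diagonal : ∀ n v {i j : Fin n} → i ≢ j → scalarI n v i j ≡ 0ℤ
scalarI-off-diagonal n v {i} {j} i≢j with i ≟ j
... | yes i≡j = ⊥-elim (i≢j i≡j)
... | no _    = refl

proposition3p5 : (n : ℕ) .{{_ : NonZero n}} → 2 ≤ n → n % 4 ≡ 2 → (d : ℕ) → (c : Fin n → ℤ)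
    → c (fin0 n) ≡ + d
    → (∀ j → j ≢ fin0 n → (c j ≡ + 1) ⊎ (c j ≡ - (+ 1)))
    → (∀ i j → (circulant n c ⊗ transpose (circulant n c)) i j ≡ scalarI n (+ d * + d + + (n ∸ 1)) i j)
    → Symmetric (circulant n c)
proposition3p5 n _ n%4≡2 d c c₀≡d units CCᵀ≡λI i j with i ≟ j
... | yes refl = refl
... | no i≢j with units-≡-or-opposite (circulant-off-diagonal-unit c units i j (i≢j ∘ sym))
                                         (circulant-off-diagonal-unit c units j i i≢j)
...   | inj₁ a≡a′    = a≡a′
...   | inj₂ a+a′≡0 = ⊥-elim (%4≡2⇒4∤ n%4≡2 (4∣n orthogonal a+a′≡0))
  where
  open OppositeMirrorEntries (+ d) c c₀≡d units i≢j
  orthogonal : sum (λ k → x k * y k) ≡ 0ℤ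
  orthogonal = trans (sym (∑≡sum n _)) (trans (CCᵀ≡λI i j) (scalarI-off-diagonal n _ i≢j))
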